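{- Let $G$ be a graph, $r,k\in\mathbb{N}$, and $C\subseteq V(G)$ a clique class with $|C|>r$. Let $G'$ be the graph obtained from $G$ by deleting all but $r$ vertices of $C$. Then for all $t\le r$, $G$ is target-$t$ $k$-equidominating if and only if $G'$ is target-$t$ $k$-equidominating.
   Context: All graphs are finite, simple and undirected; $\mathbb{N}=\{1,2,\dots\}$. An mds is an inclusion-minimal set $D\subseteq V$ such that every vertex is in $D$ or adjacent to a vertex of $D$. An equidominating structure of $G$ is a pair $(w,t)$ with $t\in\mathbb{N}$, $w\colon V\to\mathbb{N}$, such that for all $D\subseteq V$: $D$ is an mds iff $\sum_{v\in D}w(v)=t$. $G$ is target-$t$ $k$-equidominating if it has an equidominating structure $(w,t)$ with $w\colon V\to\{1,\dots,k\}$. Two vertices $v,w$ are twins if $N(v)\setminus\{w\}=N(w)\setminus\{v\}$; a clique class is an equivalence class of the twin relation with at least two elements that are pairwise adjacent. -}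

module Defs where

open import Data.Nat using (ℕ; zero; suc; _+_; _≤_; _>_)
open import Data.Bool using (Bool; true; false)
open import Data.Fin using (Fin)
open import Data.Fin.Subset using (Subset; _∈_; _∉_; _⊆_; ∣_∣)
open import Data.Vec using (Vec; []; _∷_)
open import Data.Product using (Σ; ∃; _×_; _,_)
open import Data.Sum using (_⊎_)
open import Function.Bundles using (_⇔_)
open import Function.Definitions using (Injective)
open import Relation.Binary.PropositionalEquality using (_≡_; _≢_)
open import Relation.Nullary using (¬_)

record Graph : Set where
  field
    n        : ℕ
    adj      : Fin n → Fin n → Bool
    adj-sym  : ∀ u v → adj u v ≡ adj v u
    adj-irr  : ∀ v → adj v v ≡ false

open Graph public

Adj : (G : Graph) → Fin (n G) → Fin (n G) → Set
Adj G u v = adj G u v ≡ true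

Dominating : (G : Graph) → Subset (n G) → Set
Dominating G D = ∀ v → v ∈ D ⊎ (∃ λ u → u ∈ D × Adj G u v)

IsMDS : (G : Graph) → Subset (n G) → Set
IsMDS G D = Dominating G D × (∀ D′ → D′ ⊆ D → Dominating G D′ → D ⊆ D′)

wsum : ∀ {m} → (Fin m → ℕ) → Subset m → ℕ
wsum {zero}  w []          = 0
wsum {suc m} w (true ∷ D)  = w Fin.zero + wsum (λ i → w (Fin.suc i)) D
wsum {suc m} w (false ∷ D) = wsum (λ i → w (Fin.suc i)) D

IsEquidomStructure : (G : Graph) (k : ℕ) (w : Fin (n G) → ℕ) (t : ℕ) → Set
IsEquidomStructure G k w t =
  1 ≤ t × (∀ v → 1 ≤ w v × w v ≤ k) × (∀ D → IsMDS G D ⇔ (wsum w D ≡ t))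

TargetEquidominating : (G : Graph) (t k : ℕ) → Set
TargetEquidominating G t k = ∃ λ (w : Fin (n G) → ℕ) → IsEquidomStructure G k w t

Twins : (G : Graph) → Fin (n G) → Fin (n G) → Set
Twins G u v = ∀ x → x ≢ u → x ≢ v → adj G u x ≡ adj G v x

IsCliqueClass : (G : Graph) → Subset (n G) → Set
IsCliqueClass G C =
  (∃ λ u → u ∈ C)
  × (∀ u → u ∈ C → ∀ v → (v ∈ C ⇔ Twins G u v))
  × 2 ≤ ∣ C ∣
  × (∀ u v → u ∈ C → v ∈ C → u ≢ v → Adj G u v)

-- G′ is (an isomorphic copy of) the graph obtained from G by deleting the
-- vertices of C that are not in S, i.e. the subgraph of G induced by
-- V ∖ (C ∖ S), realised via an injective adjacency-preserving embedding
-- e whose image is exactly V ∖ (C ∖ S).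
IsDeletionOf : (G′ G : Graph) → (C S : Subset (n G)) → Set
IsDeletionOf G′ G C S =
  Σ (Fin (n G′) → Fin (n G)) λ e →
    Injective _≡_ _≡_ e
    × (∀ i j → adj G′ i j ≡ adj G (e i) (e j))
    × (∀ v → (∃ λ i → e i ≡ v) ⇔ (v ∉ C ⊎ v ∈ S))

module Submission where

-- The vertices of C are pairwise adjacent twins, so they all have the same
-- closed neighbourhood.  Hence (module Domination) an mds meets C in at
-- most one vertex, a vertex of C in an mds can be exchanged for any other
-- one, and the weights of an equidominating structure are constant on C.
-- Domination only depends on closed neighbourhoods, so the mds of G′ are
-- exactly the mds of G lying inside V(G′) (module Embedding); therefore a
-- structure (w , t) of G restricts to G′.  Conversely (module Deletion) a
-- structure (w′ , t) of G′ extends to G by giving the deleted vertices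
-- the common clique weight a: a set D of G whose clique part P has at
-- most r vertices may have P replaced by ∣ P ∣ retained clique vertices,
-- which changes neither its weight nor whether it is an mds, while if
-- ∣ P ∣ > r ≥ t then D is neither an mds nor of weight t.

open import Defs
open import Level using (0ℓ)
open import Data.Nat using (ℕ; zero; suc; pred; _+_; _*_; _≤_; _<_; z≤n; s≤s; _≤?_)
open import Data.Nat.Properties
  using (+-identityʳ; +-assoc; +-mono-≤; *-zeroʳ; *-suc; ≤-trans; ≤-reflexive; ≮⇒≥; ≰⇒>; <⇒≱;
         +-cancelˡ-≡; n≤1⇒n≡0∨n≡1; +-commutativeSemigroup)
open import Algebra.Properties.CommutativeSemigroup +-commutativeSemigroup using (x∙yz≈y∙xz)
open import Data.Bool using (true; false)
import Data.Bool as Bool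
open import Data.Fin using (Fin; zero; suc; _≟_)
open import Data.Fin.Properties using (suc-injective; any?; all?)
open import Data.Fin.Subset
open import Data.Fin.Subset.Properties
open import Data.Fin.Subset.Induction using (Acc; acc; ⊂-wellFounded)
open import Data.Vec using ([]; _∷_; here; there; lookup; tabulate)
open import Data.Vec.Properties using (lookup∘tabulate; []=⇒lookup; lookup⇒[]=)
open import Data.Product using (∃; ∃₂; _×_; _,_; proj₁; proj₂)
open import Data.Sum using (_⊎_; inj₁; inj₂)
open import Data.Empty using (⊥-elim) renaming (⊥ to False)
open import Function using (_∘_)
open import Function.Bundles using (_⇔_; mk⇔; Equivalence)
open import Function.Definitions using (Injective)
open import Function.Properties.Equivalence using (⇔-setoid) renaming (sym to ⇔-sym)
open import Relation.Binary.PropositionalEquality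
import Relation.Binary.Reasoning.Setoid as SetoidReasoning
open import Relation.Nullary using (¬_; Dec; yes; no)
open import Relation.Nullary.Decidable using (_⊎-dec_; _×-dec_)

private variable m : ℕ

Disjoint : Subset m → Subset m → Set
Disjoint p q = ∀ {x} → x ∈ p → x ∉ q

∈─⇒∉ : ∀ {x : Fin m} (p q : Subset m) → x ∈ p ─ q → x ∉ q
∈─⇒∉ (_ ∷ p)     (true ∷ q)  ()        here
∈─⇒∉ (true ∷ p)  (false ∷ q) here      ()
∈─⇒∉ (_ ∷ p)     (_ ∷ q)     (there h) (there h′) = ∈─⇒∉ p q h h′

∈-⇒≢ : ∀ {x y : Fin m} (p : Subset m) → x ∈ p - y → x ≢ y
∈-⇒≢ {y = y} p h refl = ∈─⇒∉ p ⁅ y ⁆ h (x∈⁅x⁆ y)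

∈-⇒∈ : ∀ {x y : Fin m} (p : Subset m) → x ∈ p - y → x ∈ p
∈-⇒∈ {y = y} p = p─q⊆p p ⁅ y ⁆

∈-insert⁻ : ∀ {v x : Fin m} (p : Subset m) → v ∈ p ∪ ⁅ x ⁆ → v ∈ p ⊎ v ≡ x
∈-insert⁻ {x = x} p h with x∈p∪q⁻ p ⁅ x ⁆ h
... | inj₁ v∈p = inj₁ v∈p
... | inj₂ v∈x = inj₂ (x∈⁅y⁆⇒x≡y x v∈x)

∈-insert-≢ : ∀ {v x : Fin m} (p : Subset m) → v ∈ p ∪ ⁅ x ⁆ → v ≢ x → v ∈ p
∈-insert-≢ p h v≢x with ∈-insert⁻ p h
... | inj₁ v∈p = v∈p
... | inj₂ v≡x = ⊥-elim (v≢x v≡x)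

inserted : (p : Subset m) (x : Fin m) → x ∈ p ∪ ⁅ x ⁆
inserted p x = x∈p∪q⁺ (inj₂ (x∈⁅x⁆ x))

remove-insert : ∀ {x : Fin m} (p : Subset m) → x ∈ p → (p - x) ∪ ⁅ x ⁆ ≡ p
remove-insert {x = x} p x∈p = ⊆-antisym ⊆p p⊆
  where
  ⊆p : (p - x) ∪ ⁅ x ⁆ ⊆ p
  ⊆p h with ∈-insert⁻ (p - x) h
  ... | inj₁ h′   = ∈-⇒∈ p h′
  ... | inj₂ refl = x∈p
  p⊆ : p ⊆ (p - x) ∪ ⁅ x ⁆
  p⊆ {z} z∈p with z ≟ x
  ... | yes refl = inserted (p - x) x
  ... | no z≢x   = x∈p∪q⁺ (inj₁ (x∈p∧x≢y⇒x∈p-y z∈p z≢x))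

split : (p q : Subset m) → p ≡ (p ─ q) ∪ (p ∩ q)
split []          []          = refl
split (true ∷ p)  (true ∷ q)  = cong (true ∷_)  (split p q)
split (true ∷ p)  (false ∷ q) = cong (true ∷_)  (split p q)
split (false ∷ p) (true ∷ q)  = cong (false ∷_) (split p q)
split (false ∷ p) (false ∷ q) = cong (false ∷_) (split p q)

∣p∣≡0⇒p≡⊥ : (p : Subset m) → ∣ p ∣ ≡ 0 → p ≡ ⊥
∣p∣≡0⇒p≡⊥ []          _ = refl
∣p∣≡0⇒p≡⊥ (false ∷ p) h = cong (false ∷_) (∣p∣≡0⇒p≡⊥ p h)

∣p∣≡1⇒singleton : (p : Subset m) → ∣ p ∣ ≡ 1 → ∃ λ x → p ≡ ⁅ x ⁆
∣p∣≡1⇒singleton (true ∷ p)  h = zero , cong (true ∷_) (∣p∣≡0⇒p≡⊥ p (cong pred h))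
∣p∣≡1⇒singleton (false ∷ p) h with ∣p∣≡1⇒singleton p h
... | x , refl = suc x , refl

1≤∣p∣⇒nonempty : (p : Subset m) → 1 ≤ ∣ p ∣ → Nonempty p
1≤∣p∣⇒nonempty (true ∷ p)  _ = zero , here
1≤∣p∣⇒nonempty (false ∷ p) h with 1≤∣p∣⇒nonempty p h
... | x , x∈p = suc x , there x∈p

2≤∣p∣⇒two-elements : (p : Subset m) → 2 ≤ ∣ p ∣ → ∃₂ λ x y → x ∈ p × y ∈ p × x ≢ y
2≤∣p∣⇒two-elements (true ∷ p) (s≤s h) with 1≤∣p∣⇒nonempty p h
... | y , y∈p = zero , suc y , here , there y∈p , λ ()
2≤∣p∣⇒two-elements (false ∷ p) h with 2≤∣p∣⇒two-elements p h
... | x , y , x∈p , y∈p , x≢y = suc x , suc y , there x∈p , there y∈p , λ eq → x≢y (suc-injective eq)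

subset-of-size : (p : Subset m) (k : ℕ) → k ≤ ∣ p ∣ → ∃ λ q → q ⊆ p × ∣ q ∣ ≡ k
subset-of-size {m} p       zero    _       = ⊥ , (λ h → ⊥-elim (∉⊥ h)) , ∣⊥∣≡0 m
subset-of-size (false ∷ p) k       h       with subset-of-size p k h
... | q , q⊆p , ∣q∣ = false ∷ q , out⊆ q⊆p , ∣q∣
subset-of-size (true ∷ p)  (suc k) (s≤s h) with subset-of-size p k h
... | q , q⊆p , ∣q∣ = true ∷ q , in⊆in q⊆p , cong suc ∣q∣

wsum-⊥ : (w : Fin m → ℕ) → wsum w ⊥ ≡ 0
wsum-⊥ {zero}  w = refl
wsum-⊥ {suc m} w = wsum-⊥ (w ∘ suc)

wsum-⁅⁆ : (w : Fin m → ℕ) (x : Fin m) → wsum w ⁅ x ⁆ ≡ w x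
wsum-⁅⁆ {suc m} w zero    = trans (cong (w zero +_) (wsum-⊥ (w ∘ suc))) (+-identityʳ (w zero))
wsum-⁅⁆ {suc m} w (suc x) = wsum-⁅⁆ (w ∘ suc) x

wsum-∪ : (w : Fin m → ℕ) (p q : Subset m) → Disjoint p q → wsum w (p ∪ q) ≡ wsum w p + wsum w q
wsum-∪ w []          []          _ = refl
wsum-∪ w (true ∷ p)  (true ∷ q)  d = ⊥-elim (d here here)
wsum-∪ w (true ∷ p)  (false ∷ q) d =
  trans (cong (w zero +_) (wsum-∪ (w ∘ suc) p q (λ x y → d (there x) (there y))))
        (sym (+-assoc (w zero) _ _))
wsum-∪ w (false ∷ p) (true ∷ q)  d =
  trans (cong (w zero +_) (wsum-∪ (w ∘ suc) p q (λ x y → d (there x) (there y))))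
        (x∙yz≈y∙xz (w zero) (wsum (w ∘ suc) p) (wsum (w ∘ suc) q))
wsum-∪ w (false ∷ p) (false ∷ q) d = wsum-∪ (w ∘ suc) p q (λ x y → d (there x) (there y))

wsum-insert : (w : Fin m → ℕ) (p : Subset m) {x : Fin m} → x ∉ p → wsum w (p ∪ ⁅ x ⁆) ≡ wsum w p + w x
wsum-insert w p {x} x∉p =
  trans (wsum-∪ w p ⁅ x ⁆ (λ z∈p z∈x → x∉p (subst (_∈ p) (x∈⁅y⁆⇒x≡y x z∈x) z∈p)))
        (cong (wsum w p +_) (wsum-⁅⁆ w x))

wsum-cong : {w w′ : Fin m → ℕ} → (∀ x → w x ≡ w′ x) → (p : Subset m) → wsum w p ≡ wsum w′ p
wsum-cong h []          = refl
wsum-cong h (true ∷ p)  = cong₂ _+_ (h zero) (wsum-cong (λ x → h (suc x)) p)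
wsum-cong h (false ∷ p) = wsum-cong (λ x → h (suc x)) p

wsum-const : (w : Fin m → ℕ) (a : ℕ) (p : Subset m) → (∀ {x} → x ∈ p → w x ≡ a) → wsum w p ≡ a * ∣ p ∣
wsum-const w a []          _ = sym (*-zeroʳ a)
wsum-const w a (true ∷ p)  h =
  trans (cong₂ _+_ (h here) (wsum-const (w ∘ suc) a p (λ x∈p → h (there x∈p)))) (sym (*-suc a ∣ p ∣))
wsum-const w a (false ∷ p) h = wsum-const (w ∘ suc) a p (λ x∈p → h (there x∈p))

∣p∣≤wsum : (w : Fin m → ℕ) (p : Subset m) → (∀ x → 1 ≤ w x) → ∣ p ∣ ≤ wsum w p
∣p∣≤wsum w []          _ = z≤n
∣p∣≤wsum w (true ∷ p)  h = +-mono-≤ (h zero) (∣p∣≤wsum (w ∘ suc) p (λ x → h (suc x)))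
∣p∣≤wsum w (false ∷ p) h = ∣p∣≤wsum (w ∘ suc) p (λ x → h (suc x))

-- The image of D under e, defined by recursion so that weight sums of
-- images can be computed (wsum-image).
image : ∀ {N} → (Fin m → Fin N) → Subset m → Subset N
image e []          = ⊥
image e (true ∷ D)  = ⁅ e zero ⁆ ∪ image (e ∘ suc) D
image e (false ∷ D) = image (e ∘ suc) D

∈-image⁺ : ∀ {N} (e : Fin m → Fin N) (D : Subset m) {i} → i ∈ D → e i ∈ image e D
∈-image⁺ e (true ∷ D)  here      = x∈p∪q⁺ (inj₁ (x∈⁅x⁆ (e zero)))
∈-image⁺ e (true ∷ D)  (there h) = x∈p∪q⁺ (inj₂ (∈-image⁺ (e ∘ suc) D h))
∈-image⁺ e (false ∷ D) (there h) = ∈-image⁺ (e ∘ suc) D h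

∈-image⁻ : ∀ {N} (e : Fin m → Fin N) (D : Subset m) {v} → v ∈ image e D → ∃ λ i → i ∈ D × e i ≡ v
∈-image⁻ e []          h = ⊥-elim (∉⊥ h)
∈-image⁻ e (true ∷ D)  h with x∈p∪q⁻ ⁅ e zero ⁆ (image (e ∘ suc) D) h
... | inj₁ h′ = zero , here , sym (x∈⁅y⁆⇒x≡y (e zero) h′)
... | inj₂ h′ with ∈-image⁻ (e ∘ suc) D h′
...   | i , i∈D , eq = suc i , there i∈D , eq
∈-image⁻ e (false ∷ D) h with ∈-image⁻ (e ∘ suc) D h
... | i , i∈D , eq = suc i , there i∈D , eq

wsum-image : ∀ {N} (w : Fin N → ℕ) (e : Fin m → Fin N) → Injective _≡_ _≡_ e →
             (D : Subset m) → wsum w (image e D) ≡ wsum (w ∘ e) D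
wsum-image w e inj []          = wsum-⊥ w
wsum-image w e inj (true ∷ D)  =
  trans (wsum-∪ w ⁅ e zero ⁆ (image (e ∘ suc) D) disjoint)
        (cong₂ _+_ (wsum-⁅⁆ w (e zero)) (wsum-image w (e ∘ suc) (suc-injective ∘ inj) D))
  where
  disjoint : Disjoint ⁅ e zero ⁆ (image (e ∘ suc) D)
  disjoint h h′ with ∈-image⁻ (e ∘ suc) D h′
  ... | i , _ , eq with inj (trans eq (x∈⁅y⁆⇒x≡y (e zero) h))
  ... | ()
wsum-image w e inj (false ∷ D) = wsum-image w (e ∘ suc) (suc-injective ∘ inj) D

preimage : ∀ {N} → (Fin m → Fin N) → Subset N → Subset m
preimage e D = tabulate (λ i → lookup D (e i))

∈-preimage⁺ : ∀ {N} (e : Fin m → Fin N) (D : Subset N) {i} → e i ∈ D → i ∈ preimage e D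
∈-preimage⁺ e D {i} h =
  lookup⇒[]= i (preimage e D) (trans (lookup∘tabulate (lookup D ∘ e) i) ([]=⇒lookup h))

∈-preimage⁻ : ∀ {N} (e : Fin m → Fin N) (D : Subset N) {i} → i ∈ preimage e D → e i ∈ D
∈-preimage⁻ e D {i} h =
  lookup⇒[]= (e i) D (trans (sym (lookup∘tabulate (lookup D ∘ e) i)) ([]=⇒lookup h))

WithinImage : ∀ {N} → (Fin m → Fin N) → Subset N → Set
WithinImage e D = ∀ {v} → v ∈ D → ∃ λ i → e i ≡ v

∈-image-injective : ∀ {N} (e : Fin m → Fin N) → Injective _≡_ _≡_ e →
                    (D : Subset m) {i : Fin m} → e i ∈ image e D → i ∈ D
∈-image-injective e inj D h with ∈-image⁻ e D h
... | j , j∈D , eq = subst (_∈ D) (inj eq) j∈D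

image-mono : ∀ {N} (e : Fin m → Fin N) {D D′ : Subset m} → D ⊆ D′ → image e D ⊆ image e D′
image-mono e {D} {D′} D⊆D′ h with ∈-image⁻ e D h
... | i , i∈D , refl = ∈-image⁺ e D′ (D⊆D′ i∈D)

image-preimage : ∀ {N} (e : Fin m → Fin N) (D : Subset N) → WithinImage e D → image e (preimage e D) ≡ D
image-preimage e D within = ⊆-antisym ⊆D D⊆
  where
  ⊆D : image e (preimage e D) ⊆ D
  ⊆D h with ∈-image⁻ e (preimage e D) h
  ... | i , i∈ , refl = ∈-preimage⁻ e D i∈
  D⊆ : D ⊆ image e (preimage e D)
  D⊆ h with within h
  ... | i , refl = ∈-image⁺ e (preimage e D) (∈-preimage⁺ e D h)

module Domination (H : Graph) where

  private
    V : Set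
    V = Fin (n H)
    variable
      x y : V
      A D P Q : Subset (n H)

  open Equivalence using (to; from)

  Near : V → V → Set
  Near u v = u ≡ v ⊎ Adj H u v

  Near-sym : ∀ {u v} → Near u v → Near v u
  Near-sym (inj₁ refl) = inj₁ refl
  Near-sym {u} {v} (inj₂ a) = inj₂ (trans (adj-sym H v u) a)

  dominator : Dominating H D → ∀ v → ∃ λ u → u ∈ D × Near u v
  dominator d v with d v
  ... | inj₁ v∈D           = v , v∈D , inj₁ refl
  ... | inj₂ (u , u∈D , a) = u , u∈D , inj₂ a

  dominating : (∀ v → ∃ λ u → u ∈ D × Near u v) → Dominating H D
  dominating h v with h v
  ... | u , u∈D , inj₁ refl = inj₁ u∈D
  ... | u , u∈D , inj₂ a    = inj₂ (u , u∈D , a)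

  dominating? : (D : Subset (n H)) → Dec (Dominating H D)
  dominating? D = all? (λ v → (v ∈? D) ⊎-dec any? (λ u → (u ∈? D) ×-dec (adj H u v Bool.≟ true)))

  _≼_ : V → V → Set
  x ≼ y = ∀ z → Near x z → Near y z

  dominating-exchange : ∀ {X} → x ≼ y → Dominating H D → y ∈ X →
                        (∀ {v} → v ∈ D → v ≢ x → v ∈ X) → Dominating H X
  dominating-exchange {x} {y} {D} {X} x≼y d y∈X keep = dominating witness
    where
    witness : ∀ v → ∃ λ u → u ∈ X × Near u v
    witness v with dominator d v
    ... | u , u∈D , near with u ≟ x
    ...   | yes refl = y , y∈X , x≼y v near
    ...   | no u≢x   = u , keep u∈D u≢x , near

  AdjTwins : V → V → Set
  AdjTwins x y = x ≢ y × Adj H x y × Twins H x y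

  AdjTwins-sym : AdjTwins x y → AdjTwins y x
  AdjTwins-sym {x} {y} (x≢y , a , tw) =
    (λ eq → x≢y (sym eq)) , trans (adj-sym H y x) a , λ z z≢y z≢x → sym (tw z z≢x z≢y)

  AdjTwins⇒≼ : AdjTwins x y → x ≼ y
  AdjTwins⇒≼ {x} {y} (_ , a , _)  z (inj₁ refl) = inj₂ (trans (adj-sym H y x) a)
  AdjTwins⇒≼ {x} {y} (_ , _ , tw) z (inj₂ a) with y ≟ z
  ... | yes y≡z = inj₁ y≡z
  ... | no y≢z  = inj₂ (trans (sym (tw z z≢x (λ eq → y≢z (sym eq)))) a)
    where
    z≢x : z ≢ x
    z≢x refl with trans (sym a) (adj-irr H z)
    ... | ()

  -- An mds never contains two distinct adjacent twins: dropping one of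
  -- them would still dominate.
  twins-exclusive : AdjTwins x y → IsMDS H D → x ∈ D → y ∈ D → False
  twins-exclusive {x} {y} {D} tw (dom , minimal) x∈D y∈D =
    ∈-⇒≢ D (minimal (D - x) (p─q⊆p D ⁅ x ⁆) dom′ x∈D) refl
    where
    dom′ : Dominating H (D - x)
    dom′ = dominating-exchange (AdjTwins⇒≼ tw) dom
             (x∈p∧x≢y⇒x∈p-y y∈D (λ eq → proj₁ tw (sym eq))) x∈p∧x≢y⇒x∈p-y

  twin-swap : AdjTwins x y → x ∉ A → IsMDS H (A ∪ ⁅ x ⁆) → IsMDS H (A ∪ ⁅ y ⁆)
  twin-swap {x} {y} {A} tw x∉A (dom , minimal) = dom′ , minimal′
    where
    dom′ : Dominating H (A ∪ ⁅ y ⁆)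
    dom′ = dominating-exchange (AdjTwins⇒≼ tw) dom (inserted A y)
             (λ v∈ v≢x → x∈p∪q⁺ (inj₁ (∈-insert-≢ A v∈ v≢x)))
    minimal′ : ∀ D′ → D′ ⊆ A ∪ ⁅ y ⁆ → Dominating H D′ → A ∪ ⁅ y ⁆ ⊆ D′
    minimal′ D′ D′⊆ domD′ with y ∈? D′
    ... | no y∉D′ = ⊥-elim (x∉A (D′⊆A (minimal D′ D′⊆A∪x domD′ (inserted A x))))
      where
      -- Without y, D′ lies in A and hence in A ∪ ⁅ x ⁆, forcing x ∈ A.
      D′⊆A : D′ ⊆ A
      D′⊆A v∈D′ = ∈-insert-≢ A (D′⊆ v∈D′) (λ { refl → y∉D′ v∈D′ })
      D′⊆A∪x : D′ ⊆ A ∪ ⁅ x ⁆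
      D′⊆A∪x v∈D′ = x∈p∪q⁺ (inj₁ (D′⊆A v∈D′))
    ... | yes y∈D′ = A∪y⊆D′
      where
      -- Undo the swap inside D′: X is dominating and lies in A ∪ ⁅ x ⁆.
      X : Subset (n H)
      X = (D′ - y) ∪ ⁅ x ⁆
      domX : Dominating H X
      domX = dominating-exchange (AdjTwins⇒≼ (AdjTwins-sym tw)) domD′ (inserted (D′ - y) x)
               (λ v∈D′ v≢y → x∈p∪q⁺ (inj₁ (x∈p∧x≢y⇒x∈p-y v∈D′ v≢y)))
      X⊆ : X ⊆ A ∪ ⁅ x ⁆
      X⊆ v∈X with ∈-insert⁻ (D′ - y) v∈X
      ... | inj₁ v∈ = x∈p∪q⁺ (inj₁ (∈-insert-≢ A (D′⊆ (∈-⇒∈ D′ v∈)) (∈-⇒≢ D′ v∈)))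
      ... | inj₂ refl = inserted A x
      A∪y⊆D′ : A ∪ ⁅ y ⁆ ⊆ D′
      A∪y⊆D′ v∈ with ∈-insert⁻ A v∈
      ... | inj₂ refl = y∈D′
      ... | inj₁ v∈A with ∈-insert⁻ (D′ - y) (minimal X X⊆ domX (x∈p∪q⁺ (inj₁ v∈A)))
      ...   | inj₁ v∈D′-y = ∈-⇒∈ D′ v∈D′-y
      ...   | inj₂ refl   = ⊥-elim (x∉A v∈A)

  -- A dominating set from which no single vertex can be dropped is minimal,
  -- since domination is upward closed.
  irredundant⇒minimal : (∀ {v} → v ∈ D → ¬ Dominating H (D - v)) →
                        ∀ D′ → D′ ⊆ D → Dominating H D′ → D ⊆ D′
  irredundant⇒minimal {D} irr D′ D′⊆D domD′ {v} v∈D with v ∈? D′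
  ... | yes v∈D′ = v∈D′
  ... | no v∉D′  = ⊥-elim (irr v∈D (dominating λ z → shrink (dominator domD′ z)))
    where
    shrink : ∀ {z} → (∃ λ u → u ∈ D′ × Near u z) → ∃ λ u → u ∈ D - v × Near u z
    shrink (u , u∈D′ , near) = u , x∈p∧x≢y⇒x∈p-y (D′⊆D u∈D′) (λ { refl → v∉D′ u∈D′ }) , near

  mds-within : ∀ X → Dominating H X → ∃ λ M → M ⊆ X × IsMDS H M
  mds-within X = go X (⊂-wellFounded X)
    where
    go : ∀ X → Acc _⊂_ X → Dominating H X → ∃ λ M → M ⊆ X × IsMDS H M
    go X (acc rec) dom with any? (λ v → (v ∈? X) ×-dec dominating? (X - v))
    ... | yes (v , v∈X , dom′) with go (X - v) (rec (x∈p⇒p-x⊂p v∈X)) dom′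
    ...   | M , M⊆ , mds = M , (λ h → p─q⊆p X ⁅ v ⁆ (M⊆ h)) , mds
    go X (acc rec) dom | no irr =
      X , (λ h → h) , dom , irredundant⇒minimal (λ v∈X dom′ → irr (_ , v∈X , dom′))

  -- Every vertex s lies in some mds: s together with its non-neighbours
  -- dominates H, and an mds inside that set must contain s, because no
  -- other vertex of the set is adjacent to s.
  mds-through : ∀ s → ∃ λ M → s ∈ M × IsMDS H M
  mds-through s = through (mds-within X dom-X)
    where
    neighbours : Subset (n H)
    neighbours = tabulate (adj H s)

    X : Subset (n H)
    X = ⁅ s ⁆ ∪ ∁ neighbours

    neighbour⁺ : ∀ {v} → Adj H s v → v ∈ neighbours
    neighbour⁺ {v} a = lookup⇒[]= v neighbours (trans (lookup∘tabulate (adj H s) v) a)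

    neighbour⁻ : ∀ {v} → v ∈ neighbours → Adj H s v
    neighbour⁻ {v} h = trans (sym (lookup∘tabulate (adj H s) v)) ([]=⇒lookup h)

    dom-X : Dominating H X
    dom-X = dominating cover
      where
      cover : ∀ v → ∃ λ u → u ∈ X × Near u v
      cover v with adj H s v Bool.≟ true
      ... | yes a = s , x∈p∪q⁺ (inj₁ (x∈⁅x⁆ s)) , inj₂ a
      ... | no ¬a = v , x∈p∪q⁺ (inj₂ (x∉p⇒x∈∁p (¬a ∘ neighbour⁻))) , inj₁ refl

    through : (∃ λ M → M ⊆ X × IsMDS H M) → ∃ λ M → s ∈ M × IsMDS H M
    through (M , M⊆X , mds) = M , s∈M , mds
      where
      s∈M : s ∈ M
      s∈M with dominator (proj₁ mds) s
      ... | u , u∈M , inj₁ refl = u∈M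
      ... | u , u∈M , inj₂ a with x∈p∪q⁻ ⁅ s ⁆ (∁ neighbours) (M⊆X u∈M)
      ...   | inj₂ u∈∁ = ⊥-elim (x∈∁p⇒x∉p u∈∁ (neighbour⁺ (trans (adj-sym H s u) a)))
      ...   | inj₁ u∈s with x∈⁅y⁆⇒x≡y s u∈s
      ...     | refl with trans (sym a) (adj-irr H u)
      ...       | ()

  TwinClique : Subset (n H) → Set
  TwinClique K = ∀ {x y} → x ∈ K → y ∈ K → x ≢ y → AdjTwins x y

  mds-meets-clique-once : ∀ {K} → TwinClique K → IsMDS H D → P ⊆ D → P ⊆ K → ∣ P ∣ ≤ 1
  mds-meets-clique-once {P = P} clique mds P⊆D P⊆K = ≮⇒≥ two-impossible
    where
    two-impossible : ¬ (2 ≤ ∣ P ∣)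
    two-impossible 2≤∣P∣ with 2≤∣p∣⇒two-elements P 2≤∣P∣
    ... | x , y , x∈P , y∈P , x≢y =
      twins-exclusive (clique (P⊆K x∈P) (P⊆K y∈P) x≢y) mds (P⊆D x∈P) (P⊆D y∈P)

  -- Whether A ∪ P is an mds, for A outside a twin clique K and P inside
  -- it, depends only on the size of P: an mds part in K is empty or a
  -- single vertex, and single vertices of K can be swapped.
  clique-exchange : ∀ {K} → TwinClique K → Disjoint A K → P ⊆ K → Q ⊆ K → ∣ P ∣ ≡ ∣ Q ∣ →
                    IsMDS H (A ∪ P) → IsMDS H (A ∪ Q)
  clique-exchange {A} {P} {Q} clique A∩K≡∅ P⊆K Q⊆K ∣P∣≡∣Q∣ mds
    with n≤1⇒n≡0∨n≡1 (mds-meets-clique-once clique mds (q⊆p∪q A P) P⊆K)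
  ... | inj₁ ∣P∣≡0 = subst (λ R → IsMDS H (A ∪ R)) P≡Q mds
    where
    P≡Q : P ≡ Q
    P≡Q = trans (∣p∣≡0⇒p≡⊥ P ∣P∣≡0) (sym (∣p∣≡0⇒p≡⊥ Q (trans (sym ∣P∣≡∣Q∣) ∣P∣≡0)))
  ... | inj₂ ∣P∣≡1 with ∣p∣≡1⇒singleton P ∣P∣≡1 | ∣p∣≡1⇒singleton Q (trans (sym ∣P∣≡∣Q∣) ∣P∣≡1)
  ...   | p , refl | q , refl with p ≟ q
  ...     | yes refl = mds
  ...     | no p≢q   =
    twin-swap (clique (P⊆K (x∈⁅x⁆ p)) (Q⊆K (x∈⁅x⁆ q)) p≢q) (λ p∈A → A∩K≡∅ p∈A (P⊆K (x∈⁅x⁆ p))) mds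

  -- The weights of an equidominating structure agree on adjacent twins:
  -- swapping them turns an mds through one into an mds through the other.
  module _ {w : V → ℕ} {t : ℕ} (equidom : ∀ D → IsMDS H D ⇔ (wsum w D ≡ t)) where

    twins-equal-weight : AdjTwins x y → w x ≡ w y
    twins-equal-weight {x} {y} tw with mds-through x
    ... | M , x∈M , mds = +-cancelˡ-≡ (wsum w R) (w x) (w y) (begin
      wsum w R + w x     ≡⟨ wsum-insert w R x∉R ⟨
      wsum w (R ∪ ⁅ x ⁆) ≡⟨ to (equidom _) mds-x ⟩
      t                  ≡⟨ to (equidom _) mds-y ⟨
      wsum w (R ∪ ⁅ y ⁆) ≡⟨ wsum-insert w R y∉R ⟩
      wsum w R + w y     ∎)
      where
      open ≡-Reasoning
      R : Subset (n H)
      R = M - x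
      x∉R : x ∉ R
      x∉R h = ∈-⇒≢ M h refl
      y∉R : y ∉ R
      y∉R h = twins-exclusive tw mds x∈M (∈-⇒∈ M h)
      mds-x : IsMDS H (R ∪ ⁅ x ⁆)
      mds-x = subst (IsMDS H) (sym (remove-insert M x∈M)) mds
      mds-y : IsMDS H (R ∪ ⁅ y ⁆)
      mds-y = twin-swap tw x∉R mds-x

    clique-equal-weight : ∀ {K} → TwinClique K → x ∈ K → y ∈ K → w x ≡ w y
    clique-equal-weight {x} {y} clique x∈K y∈K with x ≟ y
    ... | yes refl = refl
    ... | no x≢y   = twins-equal-weight (clique x∈K y∈K x≢y)

-- Domination only depends on closed neighbourhoods, so the minimal
-- dominating sets of G′ are exactly the preimages of those of G lying in
-- the image, and equidominating structures restrict along e.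
module Embedding (G′ G : Graph) (e : Fin (n G′) → Fin (n G))
    (e-injective : Injective _≡_ _≡_ e)
    (e-adj : ∀ i j → adj G′ i j ≡ adj G (e i) (e j))
    (covered : ∀ v → (∃ λ i → e i ≡ v) ⊎ (∃ λ i → Domination._≼_ G (e i) v)) where

  private
    module Dom  = Domination G
    module Dom′ = Domination G′
    variable
      i j : Fin (n G′)
      D′ : Subset (n G′)

  open Equivalence using (to; from)

  near⁺ : Dom′.Near i j → Dom.Near (e i) (e j)
  near⁺ (inj₁ refl) = inj₁ refl
  near⁺ {i} {j} (inj₂ a) = inj₂ (trans (sym (e-adj i j)) a)

  near⁻ : Dom.Near (e i) (e j) → Dom′.Near i j
  near⁻ (inj₁ eq) = inj₁ (e-injective eq)
  near⁻ {i} {j} (inj₂ a) = inj₂ (trans (e-adj i j) a)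

  dominating-image⁺ : Dominating G′ D′ → Dominating G (image e D′)
  dominating-image⁺ {D′} d′ = Dom.dominating witness
    where
    witness : ∀ v → ∃ λ u → u ∈ image e D′ × Dom.Near u v
    witness v with covered v
    ... | inj₁ (i , refl) with Dom′.dominator d′ i
    ...   | j , j∈D′ , near = e j , ∈-image⁺ e D′ j∈D′ , near⁺ near
    witness v | inj₂ (i , ei≼v) with Dom′.dominator d′ i
    ...   | j , j∈D′ , near =
      e j , ∈-image⁺ e D′ j∈D′ , Dom.Near-sym (ei≼v (e j) (Dom.Near-sym (near⁺ near)))

  dominating-image⁻ : Dominating G (image e D′) → Dominating G′ D′
  dominating-image⁻ {D′} d = Dom′.dominating witness
    where
    witness : ∀ i → ∃ λ j → j ∈ D′ × Dom′.Near j i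
    witness i with Dom.dominator d (e i)
    ... | u , u∈ , near with ∈-image⁻ e D′ u∈
    ...   | j , j∈D′ , refl = j , j∈D′ , near⁻ near

  mds-image : IsMDS G′ D′ ⇔ IsMDS G (image e D′)
  mds-image {D′} = mk⇔ forward backward
    where
    forward : IsMDS G′ D′ → IsMDS G (image e D′)
    forward (d′ , minimal′) = dominating-image⁺ d′ , minimal
      where
      minimal : ∀ D → D ⊆ image e D′ → Dominating G D → image e D′ ⊆ D
      minimal D D⊆ d {v} v∈ with ∈-image⁻ e D′ v∈
      ... | i , i∈D′ , refl = ∈-preimage⁻ e D (minimal′ P P⊆D′ domP i∈D′)
        where
        P : Subset (n G′)
        P = preimage e D
        within : WithinImage e D
        within h with ∈-image⁻ e D′ (D⊆ h)
        ... | j , _ , eq = j , eq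
        P⊆D′ : P ⊆ D′
        P⊆D′ j∈P = ∈-image-injective e e-injective D′ (D⊆ (∈-preimage⁻ e D j∈P))
        domP : Dominating G′ P
        domP = dominating-image⁻ (subst (Dominating G) (sym (image-preimage e D within)) d)
    backward : IsMDS G (image e D′) → IsMDS G′ D′
    backward (d , minimal) = dominating-image⁻ d , minimal′
      where
      minimal′ : ∀ D″ → D″ ⊆ D′ → Dominating G′ D″ → D′ ⊆ D″
      minimal′ D″ D″⊆D′ d″ i∈D′ = ∈-image-injective e e-injective D″
        (minimal (image e D″) (image-mono e D″⊆D′) (dominating-image⁺ d″) (∈-image⁺ e D′ i∈D′))

  mds-within-image : ∀ {D} → WithinImage e D → IsMDS G D ⇔ IsMDS G′ (preimage e D)
  mds-within-image {D} within =
    subst (λ X → IsMDS G X ⇔ IsMDS G′ (preimage e D)) (image-preimage e D within) (⇔-sym mds-image)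

  wsum-within-image : (w : Fin (n G) → ℕ) {D : Subset (n G)} → WithinImage e D →
                      wsum w D ≡ wsum (w ∘ e) (preimage e D)
  wsum-within-image w {D} within =
    trans (cong (wsum w) (sym (image-preimage e D within))) (wsum-image w e e-injective (preimage e D))

  restrict : ∀ {t k} → TargetEquidominating G t k → TargetEquidominating G′ t k
  restrict (w , 1≤t , bounds , equidom) = w ∘ e , 1≤t , bounds ∘ e , λ D′ → mk⇔
    (λ mds → trans (sym (wsum-image w e e-injective D′)) (to (equidom _) (to mds-image mds)))
    (λ eq → from mds-image (from (equidom _) (trans (wsum-image w e e-injective D′) eq)))

  twins-reflect : Dom.AdjTwins (e i) (e j) → Dom′.AdjTwins i j
  twins-reflect {i} {j} (ei≢ej , a , tw) =
    (λ { refl → ei≢ej refl }) , trans (e-adj i j) a ,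
    λ x x≢i x≢j → trans (e-adj i x)
      (trans (tw (e x) (x≢i ∘ e-injective) (x≢j ∘ e-injective)) (sym (e-adj j x)))

  clique-reflect : ∀ {K} → Dom.TwinClique K → Dom′.TwinClique (preimage e K)
  clique-reflect clique i∈K j∈K i≢j =
    twins-reflect (clique (∈-preimage⁻ e _ i∈K) (∈-preimage⁻ e _ j∈K) (i≢j ∘ e-injective))

module Deletion (G : Graph) (r : ℕ) (1≤r : 1 ≤ r)
    (C : Subset (n G)) (clique-class : IsCliqueClass G C)
    (S : Subset (n G)) (S⊆C : S ⊆ C) (∣S∣≡r : ∣ S ∣ ≡ r)
    (G′ : Graph) (deletion : IsDeletionOf G′ G C S) where

  open Domination G
  open Equivalence using (to; from)

  e : Fin (n G′) → Fin (n G)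
  e = proj₁ deletion

  e-injective : Injective _≡_ _≡_ e
  e-injective = proj₁ (proj₂ deletion)

  e-image : ∀ v → (∃ λ i → e i ≡ v) ⇔ (v ∉ C ⊎ v ∈ S)
  e-image = proj₂ (proj₂ (proj₂ deletion))

  clique : TwinClique C
  clique {x} {y} x∈C y∈C x≢y =
    x≢y , proj₂ (proj₂ (proj₂ clique-class)) x y x∈C y∈C x≢y ,
    to (proj₁ (proj₂ clique-class) x x∈C y) y∈C

  retained : ∃ λ i₀ → e i₀ ∈ S
  retained with 1≤∣p∣⇒nonempty S (subst (1 ≤_) (sym ∣S∣≡r) 1≤r)
  ... | s , s∈S with from (e-image s) (inj₂ s∈S)
  ...   | i₀ , refl = i₀ , s∈S

  i₀ : Fin (n G′)
  i₀ = proj₁ retained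

  e-i₀∈C : e i₀ ∈ C
  e-i₀∈C = S⊆C (proj₂ retained)

  -- Each deleted vertex is a twin of the retained vertex e i₀.
  covered : ∀ v → (∃ λ i → e i ≡ v) ⊎ (∃ λ i → e i ≼ v)
  covered v with v ∈? C
  ... | no v∉C = inj₁ (from (e-image v) (inj₁ v∉C))
  ... | yes v∈C with v ∈? S
  ...   | yes v∈S = inj₁ (from (e-image v) (inj₂ v∈S))
  ...   | no v∉S  = inj₂ (i₀ , AdjTwins⇒≼ (clique e-i₀∈C v∈C λ { refl → v∉S (proj₂ retained) }))

  open Embedding G′ G e e-injective (proj₁ (proj₂ (proj₂ deletion))) covered public

  -- A left inverse of e, sending deleted vertices to i₀.
  retract : Fin (n G) → Fin (n G′)
  retract v with any? (λ i → e i ≟ v)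
  ... | yes (i , _) = i
  ... | no _        = i₀

  retract-e : ∀ i → retract (e i) ≡ i
  retract-e i with any? (λ j → e j ≟ e i)
  ... | yes (j , eq) = e-injective eq
  ... | no ∄         = ⊥-elim (∄ (i , refl))

  retract-clique : ∀ {v} → v ∈ C → e (retract v) ∈ C
  retract-clique {v} v∈C with any? (λ i → e i ≟ v)
  ... | yes (i , refl) = v∈C
  ... | no _           = e-i₀∈C

  -- An equidominating structure (w′ , t) of G′ with t ≤ r extends to G by
  -- giving every deleted vertex the common weight a of the clique.
  module Extension {t : ℕ} (t≤r : t ≤ r) (w′ : Fin (n G′) → ℕ) (w′-positive : ∀ i → 1 ≤ w′ i)
      (equidom′ : ∀ D′ → IsMDS G′ D′ ⇔ (wsum w′ D′ ≡ t)) where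

    w : Fin (n G) → ℕ
    w = w′ ∘ retract

    w-e : ∀ i → w (e i) ≡ w′ i
    w-e i = cong w′ (retract-e i)

    a : ℕ
    a = w′ i₀

    w-clique : ∀ {v} → v ∈ C → w v ≡ a
    w-clique v∈C = Domination.clique-equal-weight G′ equidom′ (clique-reflect clique)
      (∈-preimage⁺ e C (retract-clique v∈C)) (∈-preimage⁺ e C e-i₀∈C)

    wsum-clique-part : ∀ {A P} → Disjoint A C → P ⊆ C → wsum w (A ∪ P) ≡ wsum w A + a * ∣ P ∣
    wsum-clique-part {A} {P} A∩C≡∅ P⊆C =
      trans (wsum-∪ w A P (λ x∈A x∈P → A∩C≡∅ x∈A (P⊆C x∈P)))
            (cong (wsum w A +_) (wsum-const w a P (w-clique ∘ P⊆C)))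

    wsum-clique-exchange : ∀ {A P Q} → Disjoint A C → P ⊆ C → Q ⊆ C → ∣ P ∣ ≡ ∣ Q ∣ →
                           wsum w (A ∪ P) ≡ wsum w (A ∪ Q)
    wsum-clique-exchange {A} A∩C≡∅ P⊆C Q⊆C ∣P∣≡∣Q∣ =
      trans (wsum-clique-part A∩C≡∅ P⊆C)
            (trans (cong (λ k → wsum w A + a * k) ∣P∣≡∣Q∣) (sym (wsum-clique-part A∩C≡∅ Q⊆C)))

    -- A set meeting C in more than r ≥ 1 vertices is no mds, and with
    -- positive weights it weighs more than r ≥ t.
    oversized : ∀ D → r < ∣ D ∩ C ∣ → ¬ IsMDS G D × wsum w D ≢ t
    oversized D r<∣P∣ = not-mds , not-weight
      where
      not-mds : ¬ IsMDS G D
      not-mds mds = <⇒≱ (≤-trans (s≤s 1≤r) r<∣P∣)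
                      (mds-meets-clique-once clique mds (p∩q⊆p D C) (p∩q⊆q D C))
      not-weight : wsum w D ≢ t
      not-weight eq = <⇒≱ r<∣P∣ (≤-trans (p⊆q⇒∣p∣≤∣q∣ (p∩q⊆p D C))
                        (≤-trans (∣p∣≤wsum w D (w′-positive ∘ retract)) (≤-trans (≤-reflexive eq) t≤r)))

    -- If its clique part P has at most
    -- r vertices, replace P by ∣ P ∣ retained clique vertices T: this changes
    -- neither the weight nor being an mds, and A ∪ T lives in G′.
    equidom : ∀ D → IsMDS G D ⇔ (wsum w D ≡ t)
    equidom D with ∣ D ∩ C ∣ ≤? r
    ... | no ∣P∣≰r = mk⇔ (⊥-elim ∘ proj₁ too-big) (⊥-elim ∘ proj₂ too-big)
      where
      too-big : ¬ IsMDS G D × wsum w D ≢ t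
      too-big = oversized D (≰⇒> ∣P∣≰r)
    ... | yes ∣P∣≤r with subset-of-size S ∣ D ∩ C ∣ (subst (∣ D ∩ C ∣ ≤_) (sym ∣S∣≡r) ∣P∣≤r)
    ...   | T , T⊆S , ∣T∣≡∣P∣ = begin
      IsMDS G D                        ≡⟨ cong (IsMDS G) (split D C) ⟩
      IsMDS G (A ∪ P)                  ≈⟨ mk⇔ (clique-exchange clique A∩C≡∅ P⊆C T⊆C (sym ∣T∣≡∣P∣))
                                              (clique-exchange clique A∩C≡∅ T⊆C P⊆C ∣T∣≡∣P∣) ⟩
      IsMDS G (A ∪ T)                  ≈⟨ mds-within-image within ⟩
      IsMDS G′ (preimage e (A ∪ T))    ≈⟨ equidom′ _ ⟩
      wsum w′ (preimage e (A ∪ T)) ≡ t ≡⟨ cong (_≡ t) same-weight ⟩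
      wsum w D ≡ t                     ∎
      where
      open SetoidReasoning (⇔-setoid 0ℓ)
      A P : Subset (n G)
      A = D ─ C
      P = D ∩ C
      A∩C≡∅ : Disjoint A C
      A∩C≡∅ = ∈─⇒∉ D C
      P⊆C : P ⊆ C
      P⊆C = p∩q⊆q D C
      T⊆C : T ⊆ C
      T⊆C = S⊆C ∘ T⊆S
      within : WithinImage e (A ∪ T)
      within {v} h with x∈p∪q⁻ A T h
      ... | inj₁ v∈A = from (e-image v) (inj₁ (A∩C≡∅ v∈A))
      ... | inj₂ v∈T = from (e-image v) (inj₂ (T⊆S v∈T))
      same-weight : wsum w′ (preimage e (A ∪ T)) ≡ wsum w D
      same-weight = ≡.begin
        wsum w′ (preimage e (A ∪ T))      ≡.≡⟨ wsum-cong (sym ∘ w-e) _ ⟩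
        wsum (w ∘ e) (preimage e (A ∪ T)) ≡.≡⟨ wsum-within-image w within ⟨
        wsum w (A ∪ T)                    ≡.≡⟨ wsum-clique-exchange A∩C≡∅ T⊆C P⊆C ∣T∣≡∣P∣ ⟩
        wsum w (A ∪ P)                    ≡.≡⟨ cong (wsum w) (split D C) ⟨
        wsum w D                          ≡.∎
        where module ≡ = ≡-Reasoning

  extend : ∀ {t k} → t ≤ r → TargetEquidominating G′ t k → TargetEquidominating G t k
  extend t≤r (w′ , 1≤t , bounds , equidom′) =
    w , 1≤t , bounds ∘ retract , equidom
    where open Extension t≤r w′ (proj₁ ∘ bounds) equidom′

lemma5p2 : (G : Graph) (r k : ℕ) → 1 ≤ r → 1 ≤ k →
    (C : Subset (n G)) → IsCliqueClass G C → r < ∣ C ∣ →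
    (S : Subset (n G)) → S ⊆ C → ∣ S ∣ ≡ r →
    (G′ : Graph) → IsDeletionOf G′ G C S →
    ∀ t → t ≤ r → (TargetEquidominating G t k ⇔ TargetEquidominating G′ t k)
lemma5p2 G r k 1≤r _ C clique-class _ S S⊆C ∣S∣≡r G′ deletion t t≤r = mk⇔ restrict (extend t≤r)
  where open Deletion G r 1≤r C clique-class S S⊆C ∣S∣≡r G′ deletion
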